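{- Let $M=M_I(k)^*$ for some $k\geq 3$, or $M=M_V^*$. If $a$ is any binary sequence whose length equals the number of rows of $M$, then $a\odot M$ is a minimal forbidden submatrix for the circular-ones property.
   Context: All matrices are binary. A matrix has the circular-ones property if its columns can be circularly arranged so that the $1$'s of each row occur consecutively. A matrix is a minimal forbidden submatrix for the circular-ones property if it does not have the property but every submatrix of it different from itself does. $M^*$ is obtained from $M$ by appending a last all-zero column. For a binary sequence $a=a_1\dots a_k$ and a $k$-row matrix $M$, $a\odot M$ is obtained by complementing each row $i$ with $a_i=1$. For $k\geq3$, $M_I(k)$ is the $k\times k$ matrix whose row $i<k$ has ones exactly in columns $i,i+1$ and whose row $k$ has ones exactly in columns $1,k$. $M_V$ is the $4\times5$ matrix with rows $(1,1,0,0,0),(1,1,1,1,0),(0,0,1,1,0),(1,0,0,1,1)$. -}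

module Defs where

open import Data.Nat using (ℕ; zero; suc; _+_; _≤_; _<_; _<?_; _≡ᵇ_)
open import Data.Fin using (Fin; toℕ; fromℕ<) renaming (_<_ to _<ᶠ_)
open import Data.Fin.Permutation using (Permutation′; _⟨$⟩ʳ_)
open import Data.Bool using (Bool; true; false; not; _∨_; _∧_; if_then_else_)
open import Data.Vec using (Vec; []; _∷_; lookup)
open import Data.Product using (Σ; ∃; _×_)
open import Data.Sum using (_⊎_)
open import Relation.Binary.PropositionalEquality using (_≡_)
open import Relation.Nullary using (¬_; yes; no)
open import Function.Bundles using (_⇔_)

BMatrix : ℕ → ℕ → Set
BMatrix m n = Fin m → Fin n → Bool

-- Position p (of 0..n-1) lies in the circular arc of Z_n starting at s
-- (0 ≤ s ≤ n) of length ℓ (0 ≤ ℓ ≤ n), i.e. in {s, s+1, ..., s+ℓ-1} mod n.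
InArc : (n s ℓ p : ℕ) → Set
InArc n s ℓ p = (s ≤ p × p < s + ℓ) ⊎ (p + n < s + ℓ)

RowCircConsec : {n : ℕ} → Permutation′ n → (Fin n → Bool) → Set
RowCircConsec {n} π r =
  Σ ℕ λ s → Σ ℕ λ ℓ → s ≤ n × ℓ ≤ n ×
    (∀ c → (r c ≡ true) ⇔ InArc n s ℓ (toℕ (π ⟨$⟩ʳ c)))

CircularOnes : {m n : ℕ} → BMatrix m n → Set
CircularOnes {m} {n} M = Σ (Permutation′ n) λ π → ∀ i → RowCircConsec π (M i)

StrictlyIncreasing : {a b : ℕ} → (Fin a → Fin b) → Set
StrictlyIncreasing f = ∀ i j → i <ᶠ j → f i <ᶠ f j

subMatrix : {m n m' n' : ℕ} → BMatrix m n → (Fin m' → Fin m) → (Fin n' → Fin n) → BMatrix m' n'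
subMatrix M f g i j = M (f i) (g j)

MinimalForbiddenC1P : {m n : ℕ} → BMatrix m n → Set
MinimalForbiddenC1P {m} {n} M =
  ¬ CircularOnes M ×
  (∀ m' n' (f : Fin m' → Fin m) (g : Fin n' → Fin n) →
     StrictlyIncreasing f → StrictlyIncreasing g →
     (m' < m ⊎ n' < n) → CircularOnes (subMatrix M f g))

star : {m n : ℕ} → BMatrix m n → BMatrix m (suc n)
star {m} {n} M i j with toℕ j <? n
... | yes p = M i (fromℕ< p)
... | no _ = false

_⊙_ : {m n : ℕ} → (Fin m → Bool) → BMatrix m n → BMatrix m n
(a ⊙ M) i j = if a i then not (M i j) else M i j

-- M_I(k) (0-indexed): row i < k-1 has ones in columns i, i+1;
-- row k-1 has ones in columns 0 and k-1.
MI : (k : ℕ) → BMatrix k k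
MI k i j =
  (toℕ j ≡ᵇ toℕ i) ∨
  ((suc (toℕ i) ≡ᵇ k) ∧ (toℕ j ≡ᵇ 0)) ∨
  (not (suc (toℕ i) ≡ᵇ k) ∧ (toℕ j ≡ᵇ suc (toℕ i)))

MVrows : Vec (Vec Bool 5) 4
MVrows =
  (true ∷ true ∷ false ∷ false ∷ false ∷ []) ∷
  (true ∷ true ∷ true ∷ true ∷ false ∷ []) ∷
  (false ∷ false ∷ true ∷ true ∷ false ∷ []) ∷
  (true ∷ false ∷ false ∷ true ∷ true ∷ []) ∷ []

MV : BMatrix 4 5
MV i j = lookup (lookup MVrows i) j

-- A row has its ones consecutive in a circular order of the columns iff, read along the
-- corresponding linear order, it shows no pattern x y x y with x ≠ y.  This is invariant under
-- complementing rows, so a ⊙ M has the circular-ones property iff M has, and deleting a row or a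
-- column commutes with ⊙.  An all-zero column lets us cut the circle there, turning circular ones
-- into consecutive ones; then the first column of the cycle M_I(k) is squeezed between its two
-- neighbours, and a short case analysis finds a gap in a row of M_V.  Conversely, every single row
-- or column deletion has an explicit alternation-free column order; for M_I(k)* it is the cycle
-- order with the zero column placed at the deleted row or column.
module Submission where

open import Defs
open import Data.Bool using (Bool; true; false; not; T; _∨_; _∧_; if_then_else_)
open import Data.Bool.Properties
  using (not-injective; not-involutive; T-≡; T-∨; ∨-identityʳ) renaming (_≟_ to _≟ᵇ_)
open import Data.Empty using (⊥; ⊥-elim)
open import Data.Fin using (Fin; toℕ; fromℕ; fromℕ<; inject₁; punchIn; punchOut) renaming (zero to fzero; suc to fsuc)
open import Data.Fin.Patterns using (0F; 1F; 2F; 3F; 4F; 5F)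
open import Data.Fin.Permutation using (Permutation′; _⟨$⟩ʳ_; _⟨$⟩ˡ_; permutation; inverseˡ; inverseʳ)
open import Data.Fin.Properties
  using (any?; all?; ¬∀⟶∃¬; injective⇒≤; punchOut-injective; punchIn-punchOut; punchInᵢ≢i; punchIn-injective;
         toℕ-injective; toℕ<n; toℕ-fromℕ; toℕ-fromℕ<; fromℕ<-toℕ; toℕ-inject₁)
  renaming (_≟_ to _≟ᶠ_; <-cmp to <ᶠ-cmp)
open import Data.Fin.Subset using (Subset; _∈_; _⊂_; ∣_∣; ⊤)
open import Data.Fin.Subset.Properties using (p⊂q⇒∣p∣<∣q∣; ∣⊤∣≡n; ∈⊤)
open import Data.Nat
  using (ℕ; zero; suc; _+_; _*_; _∸_; _⊔_; _≤_; _<_; _≡ᵇ_; _<ᵇ_; _≟_; _<?_; z≤n; s≤s; s≤s⁻¹; z<s)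
open import Data.Nat.Properties
open import Data.Product using (Σ; ∃; ∃₂; _×_; _,_; proj₁; proj₂)
open import Data.Sum using (_⊎_; inj₁; inj₂; [_,_]′; swap)
open import Data.Sum.Function.Propositional using (_⊎-⇔_)
open import Data.Vec using (Vec; []; _∷_; tabulate; lookup)
open import Data.Vec.Properties using (lookup∘tabulate; lookup⇒[]=; []=⇒lookup)
open import Function using (_∘_; id; flip)
open import Function.Bundles using (_⇔_; mk⇔; Equivalence)
open import Function.Definitions using (Injective)
open import Function.Properties.Equivalence using () renaming (trans to ⇔-trans; sym to ⇔-sym)
open import Relation.Binary using (tri<; tri≈; tri>)
open import Relation.Binary.PropositionalEquality
open import Relation.Nullary using (¬_; Dec; yes; no; contradiction)
open import Relation.Nullary.Decidable using (True; toWitness; _×-dec_; _→-dec_)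

private
  variable
    m n m′ n′ : ℕ

injective⇒surjective : {f : Fin n → Fin n} → Injective _≡_ _≡_ f → ∀ y → ∃ λ x → f x ≡ y
injective⇒surjective {zero} _ ()
injective⇒surjective {suc n} {f} f-injective y with any? (λ x → f x ≟ᶠ y)
... | yes hit = hit
... | no miss = contradiction (injective⇒≤ punchOut∘f-injective) 1+n≰n
  where
  y≢f : ∀ x → y ≢ f x
  y≢f x eq = miss (x , sym eq)

  punchOut∘f-injective : Injective _≡_ _≡_ (λ x → punchOut (y≢f x))
  punchOut∘f-injective eq = f-injective (punchOut-injective (y≢f _) (y≢f _) eq)

injective⇒permutation : (f : Fin n → Fin n) → Injective _≡_ _≡_ f → Permutation′ n
injective⇒permutation f f-injective =
  permutation f (proj₁ ∘ surjective) (proj₂ ∘ surjective) (λ x → f-injective (proj₂ (surjective (f x))))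
  where
  surjective : ∀ y → ∃ λ x → f x ≡ y
  surjective = injective⇒surjective f-injective

module Ranking (p : Fin n → ℕ) (p-injective : Injective _≡_ _≡_ p) where

  below : Fin n → Subset n
  below a = tabulate (λ x → p x <ᵇ p a)

  ∈-below⁻ : ∀ {a x} → x ∈ below a → p x < p a
  ∈-below⁻ {a} {x} x∈ =
    <ᵇ⇒< _ _ (Equivalence.from T-≡ (trans (sym (lookup∘tabulate _ x)) ([]=⇒lookup x∈)))

  ∈-below⁺ : ∀ {a x} → p x < p a → x ∈ below a
  ∈-below⁺ {a} {x} lt =
    lookup⇒[]= x (below a) (trans (lookup∘tabulate _ x) (Equivalence.to T-≡ (<⇒<ᵇ lt)))

  below⊂⊤ : ∀ a → below a ⊂ ⊤
  below⊂⊤ a = (λ _ → ∈⊤) , a , ∈⊤ , λ a∈ → <-irrefl refl (∈-below⁻ a∈)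

  below-⊂ : ∀ {a b} → p a < p b → below a ⊂ below b
  below-⊂ lt =
    (λ x∈ → ∈-below⁺ (<-trans (∈-below⁻ x∈) lt)) , _ , ∈-below⁺ lt , λ a∈ → <-irrefl refl (∈-below⁻ a∈)

  rank : Fin n → Fin n
  rank a = fromℕ< (subst (∣ below a ∣ <_) (∣⊤∣≡n _) (p⊂q⇒∣p∣<∣q∣ (below⊂⊤ a)))

  rank-mono : ∀ {a b} → p a < p b → toℕ (rank a) < toℕ (rank b)
  rank-mono lt = subst₂ _<_ (sym (toℕ-fromℕ< _)) (sym (toℕ-fromℕ< _)) (p⊂q⇒∣p∣<∣q∣ (below-⊂ lt))

  rank-injective : Injective _≡_ _≡_ rank
  rank-injective {a} {b} eq with <-cmp (p a) (p b)
  ... | tri< lt _ _ = contradiction (cong toℕ eq) (<⇒≢ (rank-mono lt))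
  ... | tri≈ _ e _  = p-injective e
  ... | tri> _ _ gt = contradiction (cong toℕ (sym eq)) (<⇒≢ (rank-mono gt))

  rank-reflects : ∀ {a b} → toℕ (rank a) < toℕ (rank b) → p a < p b
  rank-reflects {a} {b} lt with <-cmp (p a) (p b)
  ... | tri< l _ _  = l
  ... | tri≈ _ e _  = contradiction (cong (toℕ ∘ rank) (p-injective e)) (<⇒≢ lt)
  ... | tri> _ _ gt = contradiction lt (<-asym (rank-mono gt))

  sorting : Permutation′ n
  sorting = injective⇒permutation rank rank-injective

-- Circular arcs and alternation

NoAlternation : (Fin n → ℕ) → (Fin n → Bool) → Set
NoAlternation p r =
  ∀ a b c d → p a < p b → p b < p c → p c < p d → r a ≡ r c → r b ≡ r d → r a ≡ r b

Convex : (Fin n → ℕ) → (Fin n → Bool) → Set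
Convex p r = ∀ a b c → p a < p b → p b < p c → r a ≡ true → r c ≡ true → r b ≡ true

module _ {p : Fin n → ℕ} {r : Fin n → Bool} where

  noAlternation-cong : {r′ : Fin n → Bool} → (∀ j → r j ≡ r′ j) → NoAlternation p r → NoAlternation p r′
  noAlternation-cong r≗r′ na a b c d ab bc cd ac bd =
    trans (sym (r≗r′ a))
      (trans (na a b c d ab bc cd (trans (r≗r′ a) (trans ac (sym (r≗r′ c))))
                                  (trans (r≗r′ b) (trans bd (sym (r≗r′ d)))))
             (r≗r′ b))

  noAlternation-not : NoAlternation p r → NoAlternation p (not ∘ r)
  noAlternation-not na a b c d ab bc cd ac bd =
    cong not (na a b c d ab bc cd (not-injective ac) (not-injective bd))

  noAlternation⇒convex : ∀ z → r z ≡ false → (∀ x → x ≢ z → p z < p x) →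
                          NoAlternation p r → Convex p r
  noAlternation⇒convex z rz z-first na a b c ab bc ra rc with r b in rb
  ... | true  = refl
  ... | false = contradiction (trans (sym rz) (trans z≡a ra)) λ ()
    where
    a≢z : a ≢ z
    a≢z refl = contradiction (trans (sym ra) rz) λ ()

    z≡a : r z ≡ r a
    z≡a = na z a b c (z-first a a≢z) ab bc (trans rz (sym rb)) (trans ra (sym rc))

noAlternation-pair : ∀ {n X Y} {p : Fin n → ℕ} {r : Fin n → Bool} → X ≤ Y →
  (∀ x → r x ≡ true → p x ≡ X ⊎ p x ≡ Y) →
  (∀ x y → X < p x → p x < Y → p y < X ⊎ Y < p y → ⊥) → NoAlternation p r
noAlternation-pair {X = X} {Y} {p} {r} X≤Y ones adjacent a b c d ab bc cd ac bd = agree (r a) (r b) refl refl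
  where
  ends : ∀ {x y} → r x ≡ true → r y ≡ true → p x < p y → p x ≡ X × p y ≡ Y
  ends rx ry lt with ones _ rx | ones _ ry
  ... | inj₁ x≡X | inj₂ y≡Y = x≡X , y≡Y
  ... | inj₁ x≡X | inj₁ y≡X = contradiction (trans x≡X (sym y≡X)) (<⇒≢ lt)
  ... | inj₂ x≡Y | inj₂ y≡Y = contradiction (trans x≡Y (sym y≡Y)) (<⇒≢ lt)
  ... | inj₂ x≡Y | inj₁ y≡X = contradiction (subst₂ _≤_ (sym y≡X) (sym x≡Y) X≤Y) (<⇒≱ lt)

  agree : ∀ u v → r a ≡ u → r b ≡ v → r a ≡ r b
  agree true  true  ra rb = trans ra (sym rb)
  agree false false ra rb = trans ra (sym rb)
  agree true  false ra rb with ends ra (trans (sym ac) ra) (<-trans ab bc)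
  ... | a≡X , c≡Y =
    ⊥-elim (adjacent b d (subst (_< p b) a≡X ab) (subst (p b <_) c≡Y bc) (inj₂ (subst (_< p d) c≡Y cd)))
  agree false true  ra rb with ends rb (trans (sym bd) rb) (<-trans bc cd)
  ... | b≡X , d≡Y =
    ⊥-elim (adjacent c a (subst (_< p c) b≡X bc) (subst (p c <_) d≡Y cd) (inj₁ (subst (p a <_) b≡X ab)))

firstTrue : (r : Fin n → Bool) →
  (∀ q → r q ≡ false) ⊎ ∃ λ q → r q ≡ true × (∀ q′ → toℕ q′ < toℕ q → r q′ ≡ false)
firstTrue {zero} r = inj₁ λ ()
firstTrue {suc n} r with r fzero in r0
... | true = inj₂ (fzero , r0 , λ _ ())
... | false with firstTrue (r ∘ fsuc)
...   | inj₁ none = inj₁ λ { fzero → r0 ; (fsuc q) → none q }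
...   | inj₂ (q , rq , before) = inj₂ (fsuc q , rq , λ { fzero _ → r0 ; (fsuc q′) (s≤s lt) → before q′ lt })

lastTrue : (r : Fin n → Bool) →
  (∀ q → r q ≡ false) ⊎ ∃ λ q → r q ≡ true × (∀ q′ → toℕ q < toℕ q′ → r q′ ≡ false)
lastTrue {zero} r = inj₁ λ ()
lastTrue {suc n} r with lastTrue (r ∘ fsuc)
... | inj₂ (q , rq , after) = inj₂ (fsuc q , rq , λ { (fsuc q′) (s≤s lt) → after q′ lt })
... | inj₁ none with r fzero in r0
...   | true  = inj₂ (fzero , r0 , λ { (fsuc q′) _ → none q′ })
...   | false = inj₁ λ { fzero → r0 ; (fsuc q) → none q }

Interval : (Fin n → Bool) → ℕ → ℕ → Set
Interval r s ℓ = ∀ q → r q ≡ true ⇔ (s ≤ toℕ q × toℕ q < s + ℓ)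

convex⇒interval : ∀ {n} {r : Fin n → Bool} → Convex toℕ r → ∃₂ λ s ℓ → s + ℓ ≤ n × Interval r s ℓ
convex⇒interval {n} {r} convex with firstTrue r | lastTrue r
... | inj₁ none | _ = 0 , 0 , z≤n , λ q → mk⇔ (λ rq → contradiction (trans (sym rq) (none q)) λ ()) λ ()
... | inj₂ (f , rf , _) | inj₁ none = contradiction (trans (sym rf) (none f)) λ ()
... | inj₂ (f , rf , before) | inj₂ (l , rl , after) =
  toℕ f , suc (toℕ l) ∸ toℕ f , subst (_≤ n) (sym end) (toℕ<n l) , interval
  where
  f≤l : toℕ f ≤ toℕ l
  f≤l = ≮⇒≥ (λ l<f → contradiction (trans (sym rl) (before l l<f)) λ ())

  end : toℕ f + (suc (toℕ l) ∸ toℕ f) ≡ suc (toℕ l)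
  end = m+[n∸m]≡n (m≤n⇒m≤1+n f≤l)

  inside : ∀ q → r q ≡ true → toℕ f ≤ toℕ q × toℕ q < suc (toℕ l)
  inside q rq = ≮⇒≥ (λ q<f → contradiction (trans (sym rq) (before q q<f)) λ ())
              , s≤s (≮⇒≥ (λ l<q → contradiction (trans (sym rq) (after q l<q)) λ ()))

  one : ∀ q → toℕ f ≤ toℕ q × toℕ q < suc (toℕ l) → r q ≡ true
  one q (f≤q , s≤s q≤l) with m≤n⇒m<n∨m≡n f≤q | m≤n⇒m<n∨m≡n q≤l
  ... | inj₂ f≡q | _        = subst (λ x → r x ≡ true) (toℕ-injective f≡q) rf
  ... | _        | inj₂ q≡l = subst (λ x → r x ≡ true) (toℕ-injective (sym q≡l)) rl
  ... | inj₁ f<q | inj₁ q<l = convex f q l f<q q<l rf rl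

  interval : Interval r (toℕ f) (suc (toℕ l) ∸ toℕ f)
  interval q rewrite end = mk⇔ (inside q) (one q)

IsArc : (Fin n → Bool) → ℕ → ℕ → Set
IsArc {n} r s ℓ = ∀ q → r q ≡ true ⇔ InArc n s ℓ (toℕ q)

interval⇔inArc : ∀ {n s ℓ q} → s + ℓ ≤ n → (s ≤ q × q < s + ℓ) ⇔ InArc n s ℓ q
interval⇔inArc {n} {q = q} s+ℓ≤n = mk⇔ inj₁ λ
  { (inj₁ inside)    → inside
  ; (inj₂ q+n<s+ℓ) → contradiction (<-≤-trans q+n<s+ℓ s+ℓ≤n) (m+n≮n q n) }

outside⇔inArc : ∀ {n s ℓ q} → s + ℓ ≤ n → q < n →
                (¬ (s ≤ q × q < s + ℓ)) ⇔ InArc n (s + ℓ) (n ∸ ℓ) q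
outside⇔inArc {n} {s} {ℓ} {q} s+ℓ≤n q<n
  rewrite +-assoc s ℓ (n ∸ ℓ) | m+[n∸m]≡n (≤-trans (m≤n+m ℓ s) s+ℓ≤n) = mk⇔ to from
  where
  to : ¬ (s ≤ q × q < s + ℓ) → (s + ℓ ≤ q × q < s + n) ⊎ (q + n < s + n)
  to outside with q <? s
  ... | yes q<s = inj₂ (+-monoˡ-< n q<s)
  ... | no q≮s  = inj₁ (≮⇒≥ (λ q<s+ℓ → outside (≮⇒≥ q≮s , q<s+ℓ)) , <-≤-trans q<n (m≤n+m n s))

  from : (s + ℓ ≤ q × q < s + n) ⊎ (q + n < s + n) → ¬ (s ≤ q × q < s + ℓ)
  from (inj₁ (s+ℓ≤q , _)) (_ , q<s+ℓ) = <⇒≱ q<s+ℓ s+ℓ≤q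
  from (inj₂ q+n<s+n) (s≤q , _)       = <⇒≱ (+-cancelʳ-< n q s q+n<s+n) s≤q

≢fzero⇒0<toℕ : ∀ (x : Fin (suc n)) → x ≢ fzero → 0 < toℕ x
≢fzero⇒0<toℕ fzero    0≢0 = contradiction refl 0≢0
≢fzero⇒0<toℕ (fsuc _) _   = z<s

noAlternation⇒arc : ∀ {n} {r : Fin n → Bool} → NoAlternation toℕ r →
                    ∃₂ λ s ℓ → s ≤ n × ℓ ≤ n × IsArc r s ℓ
noAlternation⇒arc {zero} _ = 0 , 0 , z≤n , z≤n , λ ()
noAlternation⇒arc {suc n} {r} na with r fzero in r0
... | false with convex⇒interval (noAlternation⇒convex fzero r0 ≢fzero⇒0<toℕ na)
...   | s , ℓ , s+ℓ≤n , interval =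
  s , ℓ , ≤-trans (m≤m+n s ℓ) s+ℓ≤n , ≤-trans (m≤n+m ℓ s) s+ℓ≤n ,
  λ q → ⇔-trans (interval q) (interval⇔inArc s+ℓ≤n)
noAlternation⇒arc {suc n} {r} na | true
  with convex⇒interval (noAlternation⇒convex fzero (cong not r0) ≢fzero⇒0<toℕ (noAlternation-not na))
...   | s , ℓ , s+ℓ≤n , zeros = s + ℓ , suc n ∸ ℓ , s+ℓ≤n , m∸n≤m _ ℓ ,
  λ q → ⇔-trans (one⇔outside q) (outside⇔inArc s+ℓ≤n (toℕ<n q))
  where
  one⇔outside : ∀ q → r q ≡ true ⇔ (¬ (s ≤ toℕ q × toℕ q < s + ℓ))
  one⇔outside q with r q in rq
  ... | true  = mk⇔ (λ _ inside → contradiction (trans (sym (Equivalence.from (zeros q) inside)) (cong not rq)) λ ())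
                    (λ _ → refl)
  ... | false = mk⇔ (λ ()) (λ outside → contradiction (Equivalence.to (zeros q) (cong not rq)) outside)

module _ {n s ℓ : ℕ} (ℓ≤n : ℓ ≤ n) where

  private
    Arc : ℕ → Set
    Arc = InArc n s ℓ

  arc-no1010 : ∀ {a b c d} → a < b → b < c → c < d → d < n → Arc a → ¬ Arc b → Arc c → ¬ Arc d → ⊥
  arc-no1010 ab bc cd d<n (inj₁ (s≤a , _)) b∉ (inj₁ (_ , c<s+ℓ)) _ =
    b∉ (inj₁ (≤-trans s≤a (<⇒≤ ab) , <-trans bc c<s+ℓ))
  arc-no1010 ab bc cd d<n (inj₂ a+n<s+ℓ) b∉ (inj₂ c+n<s+ℓ) _ =
    b∉ (inj₂ (<-trans (+-monoˡ-< n bc) c+n<s+ℓ))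
  arc-no1010 ab bc cd d<n (inj₁ (s≤a , _)) _ (inj₂ c+n<s+ℓ) _ =
    <⇒≱ (<-≤-trans c+n<s+ℓ (+-monoʳ-≤ s ℓ≤n)) (+-monoˡ-≤ n (≤-trans s≤a (<⇒≤ (<-trans ab bc))))
  arc-no1010 {a} {d = d} ab bc cd d<n (inj₂ a+n<s+ℓ) _ (inj₁ (s≤c , _)) d∉ with d <? s + ℓ
  ... | yes d<s+ℓ = d∉ (inj₁ (≤-trans s≤c (<⇒≤ cd) , d<s+ℓ))
  ... | no d≮s+ℓ  = <⇒≱ (≤-<-trans (m≤n+m n a) a+n<s+ℓ) (≤-trans (≮⇒≥ d≮s+ℓ) (<⇒≤ d<n))

  arc-no0101 : ∀ {a b c d} → a < b → b < c → c < d → d < n → ¬ Arc a → Arc b → ¬ Arc c → Arc d → ⊥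
  arc-no0101 ab bc cd d<n a∉ (inj₂ b+n<s+ℓ) _ _ = a∉ (inj₂ (<-trans (+-monoˡ-< n ab) b+n<s+ℓ))
  arc-no0101 {c = c} ab bc cd d<n a∉ (inj₁ (s≤b , _)) c∉ d∈ with c <? s + ℓ
  ... | yes c<s+ℓ = c∉ (inj₁ (≤-trans s≤b (<⇒≤ bc) , c<s+ℓ))
  ... | no c≮s+ℓ  with d∈
  ...   | inj₁ (_ , d<s+ℓ) = <⇒≱ d<s+ℓ (≤-trans (≮⇒≥ c≮s+ℓ) (<⇒≤ cd))
  ...   | inj₂ d+n<s+ℓ    = <⇒≱ d+n<s+ℓ (≤-trans (≮⇒≥ c≮s+ℓ) (≤-trans (<⇒≤ cd) (m≤m+n _ n)))

arc⇒noAlternation : ∀ {k n s ℓ} {p : Fin k → ℕ} {r : Fin k → Bool} → (∀ x → p x < n) → ℓ ≤ n →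
                     (∀ x → r x ≡ true ⇔ InArc n s ℓ (p x)) → NoAlternation p r
arc⇒noAlternation {n = n} {s} {ℓ} {p} {r} p<n ℓ≤n arc a b c d ab bc cd ac bd = agree (r a) (r b) refl refl
  where
  ∈ : ∀ x → r x ≡ true → InArc n s ℓ (p x)
  ∈ x = Equivalence.to (arc x)

  ∉ : ∀ x → r x ≡ false → ¬ InArc n s ℓ (p x)
  ∉ x rx inside = contradiction (trans (sym (Equivalence.from (arc x) inside)) rx) λ ()

  agree : ∀ u v → r a ≡ u → r b ≡ v → r a ≡ r b
  agree true  true  ra rb = trans ra (sym rb)
  agree false false ra rb = trans ra (sym rb)
  agree true  false ra rb =
    ⊥-elim (arc-no1010 ℓ≤n ab bc cd (p<n d) (∈ a ra) (∉ b rb) (∈ c (trans (sym ac) ra))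
                                                            (∉ d (trans (sym bd) rb)))
  agree false true  ra rb =
    ⊥-elim (arc-no0101 ℓ≤n ab bc cd (p<n d) (∉ a ra) (∈ b rb) (∉ c (trans (sym ac) ra))
                                                            (∈ d (trans (sym bd) rb)))

AlternationFree : BMatrix m n → Set
AlternationFree {m} {n} M = Σ (Fin n → ℕ) λ p → Injective _≡_ _≡_ p × ∀ i → NoAlternation p (M i)

alternationFree⇒circularOnes : {M : BMatrix m n} → AlternationFree M → CircularOnes M
alternationFree⇒circularOnes {M = M} (p , p-injective , rows) = sorting , row
  where
  open Ranking p p-injective

  unsort-reflects : ∀ {x y} → toℕ x < toℕ y → p (sorting ⟨$⟩ˡ x) < p (sorting ⟨$⟩ˡ y)
  unsort-reflects lt =
    rank-reflects (subst₂ (λ u v → toℕ u < toℕ v) (sym (inverseʳ sorting)) (sym (inverseʳ sorting)) lt)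

  row : ∀ i → RowCircConsec sorting (M i)
  row i with noAlternation⇒arc {r = M i ∘ (sorting ⟨$⟩ˡ_)}
               (λ a b c d ab bc cd → rows i _ _ _ _ (unsort-reflects ab) (unsort-reflects bc) (unsort-reflects cd))
  ... | s , ℓ , s≤n , ℓ≤n , arc =
    s , ℓ , s≤n , ℓ≤n , λ c →
      subst (λ x → M i x ≡ true ⇔ InArc _ s ℓ (toℕ (sorting ⟨$⟩ʳ c))) (inverseˡ sorting) (arc (sorting ⟨$⟩ʳ c))

circularOnes⇒alternationFree : {M : BMatrix m n} → CircularOnes M → AlternationFree M
circularOnes⇒alternationFree {n = n} {M} (π , rows) = position , position-injective , noAlternation
  where
  position : Fin n → ℕ
  position c = toℕ (π ⟨$⟩ʳ c)

  position-injective : Injective _≡_ _≡_ position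
  position-injective eq = trans (sym (inverseˡ π)) (trans (cong (π ⟨$⟩ˡ_) (toℕ-injective eq)) (inverseˡ π))

  noAlternation : ∀ i → NoAlternation position (M i)
  noAlternation i with rows i
  ... | _ , _ , _ , ℓ≤n , arc = arc⇒noAlternation (λ _ → toℕ<n _) ℓ≤n arc

noAlternation? : (p : Fin n → ℕ) (r : Fin n → Bool) → Dec (NoAlternation p r)
noAlternation? p r = all? λ a → all? λ b → all? λ c → all? λ d →
  (p a <? p b) →-dec ((p b <? p c) →-dec ((p c <? p d) →-dec
  ((r a ≟ᵇ r c) →-dec ((r b ≟ᵇ r d) →-dec (r a ≟ᵇ r b)))))

injective? : (p : Fin n → ℕ) → Dec (∀ x y → p x ≡ p y → x ≡ y)
injective? p = all? λ x → all? λ y → (p x ≟ p y) →-dec (x ≟ᶠ y)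

alternationFree? : (M : BMatrix m n) (p : Fin n → ℕ) →
                   Dec ((∀ x y → p x ≡ p y → x ≡ y) × ∀ i → NoAlternation p (M i))
alternationFree? M p = injective? p ×-dec all? (λ i → noAlternation? p (M i))

circularOnes-byPositions : (M : BMatrix m n) (p : Vec ℕ n) → {True (alternationFree? M (lookup p))} → CircularOnes M
circularOnes-byPositions M p {ok} with toWitness ok
... | injective , rows = alternationFree⇒circularOnes (lookup p , injective _ _ , rows)

-- Submatrices, complements and minimality

circularOnes-subMatrix : {M : BMatrix m n} {N : BMatrix m′ n′} (f : Fin m′ → Fin m) (g : Fin n′ → Fin n) →
  Injective _≡_ _≡_ g → (∀ i j → N i j ≡ M (f i) (g j)) → CircularOnes M → CircularOnes N
circularOnes-subMatrix f g g-injective N≗ c1p with circularOnes⇒alternationFree c1p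
... | p , p-injective , rows = alternationFree⇒circularOnes
  (p ∘ g , g-injective ∘ p-injective ,
   λ i → noAlternation-cong (λ j → sym (N≗ i j)) (λ a b c d → rows (f i) (g a) (g b) (g c) (g d)))

noAlternation-complementIf : ∀ {p : Fin n → ℕ} {r} b →
  NoAlternation p r → NoAlternation p (λ j → if b then not (r j) else r j)
noAlternation-complementIf false = id
noAlternation-complementIf true  = noAlternation-not

circularOnes-⊙ : ∀ (s : Fin m → Bool) {M : BMatrix m n} → CircularOnes M → CircularOnes (s ⊙ M)
circularOnes-⊙ s c1p with circularOnes⇒alternationFree c1p
... | p , p-injective , rows =
  alternationFree⇒circularOnes (p , p-injective , λ i → noAlternation-complementIf (s i) (rows i))

⊙-involutive : ∀ (s : Fin m → Bool) (M : BMatrix m n) i j → M i j ≡ (s ⊙ (s ⊙ M)) i j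
⊙-involutive s M i j with s i
... | false = refl
... | true  = sym (not-involutive (M i j))

circularOnes-⊙⁻¹ : ∀ (s : Fin m → Bool) {M : BMatrix m n} → CircularOnes (s ⊙ M) → CircularOnes M
circularOnes-⊙⁻¹ s {M} = circularOnes-subMatrix id id id (⊙-involutive s M) ∘ circularOnes-⊙ s

deleteRow : Fin (suc m) → BMatrix (suc m) n → BMatrix m n
deleteRow r M i = M (punchIn r i)

deleteColumn : Fin (suc n) → BMatrix m (suc n) → BMatrix m n
deleteColumn c M i j = M i (punchIn c j)

missingIndex : (f : Fin m′ → Fin m) → m′ < m → ∃ λ r → ∀ i → r ≢ f i
missingIndex {m′} {m} f m′<m
  with ¬∀⟶∃¬ m (λ r → ∃ λ i → f i ≡ r) (λ r → any? (λ i → f i ≟ᶠ r)) ¬surjective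
  where
  ¬surjective : ¬ (∀ r → ∃ λ i → f i ≡ r)
  ¬surjective hit = <⇒≱ m′<m (injective⇒≤ {f = proj₁ ∘ hit}
    λ {x} {y} eq → trans (sym (proj₂ (hit x))) (trans (cong f eq) (proj₂ (hit y))))
... | r , unhit = r , λ i r≡fi → unhit (i , sym r≡fi)

strictlyIncreasing⇒injective : {g : Fin m → Fin n} → StrictlyIncreasing g → Injective _≡_ _≡_ g
strictlyIncreasing⇒injective {g = g} g-inc {x} {y} eq with <ᶠ-cmp x y
... | tri< lt _ _ = contradiction (cong toℕ eq) (<⇒≢ (g-inc x y lt))
... | tri≈ _ x≡y _ = x≡y
... | tri> _ _ gt = contradiction (cong toℕ (sym eq)) (<⇒≢ (g-inc y x gt))

minimalForbidden : {M : BMatrix (suc m) (suc n)} → ¬ CircularOnes M →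
  (∀ r → CircularOnes (deleteRow r M)) → (∀ c → CircularOnes (deleteColumn c M)) → MinimalForbiddenC1P M
minimalForbidden {m} {n} {M} ¬c1p rowDeleted columnDeleted = ¬c1p , proper
  where
  proper : ∀ m′ n′ (f : Fin m′ → Fin (suc m)) (g : Fin n′ → Fin (suc n)) →
           StrictlyIncreasing f → StrictlyIncreasing g →
           m′ < suc m ⊎ n′ < suc n → CircularOnes (subMatrix M f g)
  proper m′ n′ f g _ g-inc (inj₁ m′<) with missingIndex f m′<
  ... | r , r≢f = circularOnes-subMatrix (λ i → punchOut (r≢f i)) g (strictlyIncreasing⇒injective g-inc)
                    (λ i j → cong (λ x → M x (g j)) (sym (punchIn-punchOut (r≢f i)))) (rowDeleted r)
  proper m′ n′ f g _ g-inc (inj₂ n′<) with missingIndex g n′<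
  ... | c , c≢g = circularOnes-subMatrix f (λ j → punchOut (c≢g j))
                    (λ eq → strictlyIncreasing⇒injective g-inc (punchOut-injective (c≢g _) (c≢g _) eq))
                    (λ i j → cong (M (f i)) (sym (punchIn-punchOut (c≢g j)))) (columnDeleted c)

minimalForbidden-⊙ : {M : BMatrix (suc m) (suc n)} → ¬ CircularOnes M →
  (∀ r → CircularOnes (deleteRow r M)) → (∀ c → CircularOnes (deleteColumn c M)) →
  ∀ a → MinimalForbiddenC1P (a ⊙ M)
minimalForbidden-⊙ ¬c1p rowDeleted columnDeleted a = minimalForbidden
  (¬c1p ∘ circularOnes-⊙⁻¹ a)
  (λ r → circularOnes-⊙ (a ∘ punchIn r) (rowDeleted r))
  (λ c → circularOnes-⊙ a (columnDeleted c))

-- Cutting the circle at a zero column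

supremum : (Fin n → ℕ) → ℕ
supremum {zero}  p = 0
supremum {suc n} p = p fzero ⊔ supremum (p ∘ fsuc)

≤-supremum : ∀ (p : Fin n → ℕ) x → p x ≤ supremum p
≤-supremum p fzero    = m≤m⊔n _ _
≤-supremum p (fsuc x) = ≤-trans (≤-supremum (p ∘ fsuc) x) (m≤n⊔m _ _)

-- The columns before z are moved behind all others.
module Rotation (p : Fin n → ℕ) (p-injective : Injective _≡_ _≡_ p) (z : Fin n) where

  private
    B : ℕ
    B = suc (supremum p)

    <B : ∀ x → p x < B
    <B x = s≤s (≤-supremum p x)

  Side : Fin n → Set
  Side x = p x < p z ⊎ p z ≤ p x

  side : ∀ x → Side x
  side x with p x <? p z
  ... | yes lt = inj₁ lt
  ... | no ≮   = inj₂ (≮⇒≥ ≮)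

  rotated : Fin n → ℕ
  rotated x with side x
  ... | inj₁ _ = p x + B
  ... | inj₂ _ = p x

  rotated-before : ∀ {x} → p x < p z → rotated x ≡ p x + B
  rotated-before {x} lt with side x
  ... | inj₁ _  = refl
  ... | inj₂ ge = contradiction lt (≤⇒≯ ge)

  rotated-after : ∀ {x} → p z ≤ p x → rotated x ≡ p x
  rotated-after {x} ge with side x
  ... | inj₁ lt = contradiction lt (≤⇒≯ ge)
  ... | inj₂ _  = refl

  after<before : ∀ {x y} → p z ≤ p x → p y < p z → rotated x < rotated y
  after<before {x} {y} x-after y-before rewrite rotated-after x-after | rotated-before y-before =
    <-≤-trans (<B x) (m≤n+m B (p y))

  rotated-injective : Injective _≡_ _≡_ rotated
  rotated-injective {x} {y} eq = bySide (side x) (side y)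
    where
    bySide : Side x → Side y → x ≡ y
    bySide (inj₁ x-before) (inj₁ y-before) =
      p-injective (+-cancelʳ-≡ B _ _ (trans (sym (rotated-before x-before)) (trans eq (rotated-before y-before))))
    bySide (inj₂ x-after) (inj₂ y-after) =
      p-injective (trans (sym (rotated-after x-after)) (trans eq (rotated-after y-after)))
    bySide (inj₁ x-before) (inj₂ y-after) = contradiction (sym eq) (<⇒≢ (after<before y-after x-before))
    bySide (inj₂ x-after) (inj₁ y-before) = contradiction eq (<⇒≢ (after<before x-after y-before))

  z-first : ∀ x → x ≢ z → rotated z < rotated x
  z-first x x≢z = [ after<before ≤-refl
                  , (λ x-after → subst₂ _<_ (sym (rotated-after ≤-refl)) (sym (rotated-after x-after))
                                   (≤∧≢⇒< x-after (λ eq → x≢z (p-injective (sym eq))))) ]′ (side x)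

  before-mono : ∀ {x y} → p x < p z → p y < p z → rotated x < rotated y → p x < p y
  before-mono x-before y-before lt rewrite rotated-before x-before | rotated-before y-before = +-cancelʳ-< B _ _ lt

  after-mono : ∀ {x y} → p z ≤ p x → p z ≤ p y → rotated x < rotated y → p x < p y
  after-mono x-after y-after lt rewrite rotated-after x-after | rotated-after y-after = lt

  rotated-noAlternation : ∀ {r} → NoAlternation p r → NoAlternation rotated r
  rotated-noAlternation {r} na a b c d ab bc cd ac bd = agree (side a) (side b) (side c) (side d)
    where
    back : ∀ {x y} → p z ≤ p x → p y < p z → rotated y < rotated x → ⊥
    back x-after y-before lt = <-asym lt (after<before x-after y-before)

    agree : Side a → Side b → Side c → Side d → r a ≡ r b
    agree (inj₂ a′) (inj₂ b′) (inj₂ c′) (inj₂ d′) =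
      na a b c d (after-mono a′ b′ ab) (after-mono b′ c′ bc) (after-mono c′ d′ cd) ac bd
    agree (inj₁ a′) (inj₁ b′) (inj₁ c′) (inj₁ d′) =
      na a b c d (before-mono a′ b′ ab) (before-mono b′ c′ bc) (before-mono c′ d′ cd) ac bd
    agree (inj₂ a′) (inj₂ b′) (inj₂ c′) (inj₁ d′) =
      trans (sym (na d a b c (<-≤-trans d′ a′) (after-mono a′ b′ ab) (after-mono b′ c′ bc) (sym bd) ac)) (sym bd)
    agree (inj₂ a′) (inj₂ b′) (inj₁ c′) (inj₁ d′) =
      trans ac (trans (na c d a b (before-mono c′ d′ cd) (<-≤-trans d′ a′) (after-mono a′ b′ ab) (sym ac) (sym bd))
                      (sym bd))
    agree (inj₂ a′) (inj₁ b′) (inj₁ c′) (inj₁ d′) =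
      trans ac (sym (na b c d a (before-mono b′ c′ bc) (before-mono c′ d′ cd) (<-≤-trans d′ a′) bd (sym ac)))
    agree (inj₁ a′) (inj₂ b′) _ _ = ⊥-elim (back b′ a′ ab)
    agree _ (inj₁ b′) (inj₂ c′) _ = ⊥-elim (back c′ b′ bc)
    agree _ _ (inj₁ c′) (inj₂ d′) = ⊥-elim (back d′ c′ cd)

ConsecutiveOnes : BMatrix m n → Set
ConsecutiveOnes {m} {n} M = Σ (Fin n → ℕ) λ p → Injective _≡_ _≡_ p × ∀ i → Convex p (M i)

circularOnes⇒consecutiveOnes : {M : BMatrix m n} (z : Fin n) → (∀ i → M i z ≡ false) →
                               CircularOnes M → ConsecutiveOnes M
circularOnes⇒consecutiveOnes z z-zero c1p with circularOnes⇒alternationFree c1p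
... | p , p-injective , rows =
  rotated , rotated-injective , λ i → noAlternation⇒convex z (z-zero i) z-first (rotated-noAlternation (rows i))
  where open Rotation p p-injective z

convex-gap : ∀ {p : Fin n → ℕ} {r x y w} → Convex p r → p x < p y → p y < p w →
             r x ≡ true → r w ≡ true → r y ≡ false → ⊥
convex-gap convex xy yw rx rw ry = contradiction (trans (sym (convex _ _ _ xy yw rx rw)) ry) λ ()

module Reversal (p : Fin n → ℕ) where

  reversed : Fin n → ℕ
  reversed x = supremum p ∸ p x

  reversed-< : ∀ {x y} → p x < p y → reversed y < reversed x
  reversed-< lt = ∸-monoʳ-< lt (≤-supremum p _)

  reversed-injective : Injective _≡_ _≡_ p → Injective _≡_ _≡_ reversed
  reversed-injective p-injective eq = p-injective (∸-cancelˡ-≡ (≤-supremum p _) (≤-supremum p _) eq)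

  reversed-convex : ∀ {r} → Convex p r → Convex reversed r
  reversed-convex convex a b c ab bc = flip (convex c b a (reflects bc) (reflects ab))
    where
    reflects : ∀ {x y} → reversed x < reversed y → p y < p x
    reflects lt = ≰⇒> λ x≤y → <⇒≱ lt (∸-monoʳ-≤ (supremum p) x≤y)

≢⇒<∨> : ∀ {n} {p : Fin n → ℕ} → Injective _≡_ _≡_ p → ∀ {x y} → x ≢ y → p x < p y ⊎ p y < p x
≢⇒<∨> {p = p} p-injective {x} {y} x≢y with <-cmp (p x) (p y)
... | tri< lt _ _ = inj₁ lt
... | tri≈ _ eq _ = contradiction (p-injective eq) x≢y
... | tri> _ _ gt = inj₂ gt

argmin : ∀ {n} (f : Fin (suc n) → ℕ) → ∃ λ c → ∀ x → f c ≤ f x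
argmin {zero}  f = fzero , λ { fzero → ≤-refl }
argmin {suc n} f with argmin (f ∘ fsuc)
... | c , minimal with ≤-total (f fzero) (f (fsuc c))
...   | inj₁ le = fzero , λ { fzero → ≤-refl ; (fsuc x) → ≤-trans le (minimal x) }
...   | inj₂ le = fsuc c , λ { fzero → le ; (fsuc x) → minimal x }

star-last : ∀ {m n} (M : BMatrix m n) i → star M i (fromℕ n) ≡ false
star-last {n = n} M i with toℕ (fromℕ n) <? n
... | yes lt = contradiction (toℕ-fromℕ n) (<⇒≢ lt)
... | no _   = refl
-- The cycle M_I(k)*

next : ℕ → ℕ → ℕ
next k i = if suc i ≡ᵇ k then 0 else suc i

next-step : ∀ {k i} → suc i < k → next k i ≡ suc i
next-step {k} {i} lt with suc i ≡ᵇ k in eq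
... | true  = contradiction (≡ᵇ⇒≡ _ _ (subst T (sym eq) _)) (<⇒≢ lt)
... | false = refl

next-wrap : ∀ {k i} → suc i ≡ k → next k i ≡ 0
next-wrap {k} {i} eq with suc i ≡ᵇ k in eqᵇ
... | true  = refl
... | false = contradiction (≡⇒≡ᵇ _ _ eq) (subst T eqᵇ)

stepOrWrap : ∀ {k i} → i < k → suc i < k ⊎ suc i ≡ k
stepOrWrap = m≤n⇒m<n∨m≡n

next-< : ∀ {k i} → i < k → next k i < k
next-< {k} {i} i<k with stepOrWrap i<k
... | inj₁ lt = subst (_< k) (sym (next-step lt)) lt
... | inj₂ eq = subst (_< k) (sym (next-wrap eq)) (≤-<-trans z≤n i<k)

next-≢ : ∀ {k i} → 2 ≤ k → i < k → next k i ≢ i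
next-≢ 2≤k i<k eq with stepOrWrap i<k
... | inj₁ lt   = 1+n≢n (trans (sym (next-step lt)) eq)
... | inj₂ refl = <⇒≢ (s≤s⁻¹ 2≤k) (trans (sym (next-wrap refl)) eq)

next²-≢ : ∀ {k i} → 3 ≤ k → i < k → next k (next k i) ≢ i
next²-≢ {k} {i} 3≤k i<k with stepOrWrap i<k
... | inj₂ refl rewrite next-wrap {k} {i} refl | next-step {k} {0} (≤-trans (s≤s (s≤s z≤n)) 3≤k) =
  <⇒≢ (s≤s⁻¹ 3≤k)
... | inj₁ lt rewrite next-step lt with stepOrWrap lt
...   | inj₁ lt′ rewrite next-step lt′ = λ eq → <⇒≢ (m<n⇒m<1+n (n<1+n i)) (sym eq)
...   | inj₂ refl rewrite next-wrap {suc (suc i)} {suc i} refl = <⇒≢ (s≤s⁻¹ (s≤s⁻¹ 3≤k))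

predecessor : ∀ {k c} → c < k → ∃ λ u → u < k × next k u ≡ c
predecessor {suc k₀} {zero}  _   = k₀ , ≤-refl , next-wrap refl
predecessor {k}      {suc c} c<k = c , <-trans (n<1+n c) c<k , next-step c<k

mi : ℕ → ℕ → ℕ → Bool
mi k i j = (j ≡ᵇ i) ∨ ((suc i ≡ᵇ k) ∧ (j ≡ᵇ 0)) ∨ (not (suc i ≡ᵇ k) ∧ (j ≡ᵇ suc i))

≡ᵇ⇔≡ : ∀ m n → T (m ≡ᵇ n) ⇔ m ≡ n
≡ᵇ⇔≡ m n = mk⇔ (≡ᵇ⇒≡ m n) (≡⇒≡ᵇ m n)

mi-true : ∀ k i j → mi k i j ≡ true ⇔ (j ≡ i ⊎ j ≡ next k i)
mi-true k i j with suc i ≡ᵇ k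
... | true  rewrite ∨-identityʳ (j ≡ᵇ 0) =
  ⇔-trans (⇔-sym T-≡) (⇔-trans T-∨ (≡ᵇ⇔≡ j i ⊎-⇔ ≡ᵇ⇔≡ j 0))
... | false = ⇔-trans (⇔-sym T-≡) (⇔-trans T-∨ (≡ᵇ⇔≡ j i ⊎-⇔ ≡ᵇ⇔≡ j (suc i)))

mi-self : ∀ k i → mi k i i ≡ true
mi-self k i = Equivalence.from (mi-true k i i) (inj₁ refl)

mi-next : ∀ k i → mi k i (next k i) ≡ true
mi-next k i = Equivalence.from (mi-true k i _) (inj₂ refl)

mi-other : ∀ k {i j} → j ≢ i → j ≢ next k i → mi k i j ≡ false
mi-other k {i} {j} j≢i j≢next with mi k i j in eq
... | false = refl
... | true with Equivalence.to (mi-true k i j) eq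
...   | inj₁ j≡i    = contradiction j≡i j≢i
...   | inj₂ j≡next = contradiction j≡next j≢next

cycleColumn : ∀ {k t} → t < k → Fin (suc k)
cycleColumn lt = inject₁ (fromℕ< lt)

toℕ-cycleColumn : ∀ {k t} (lt : t < k) → toℕ (cycleColumn lt) ≡ t
toℕ-cycleColumn lt = trans (toℕ-inject₁ _) (toℕ-fromℕ< lt)

starMI-cycle : ∀ {k s t} (s<k : s < k) (t<k : t < k) → star (MI k) (fromℕ< s<k) (cycleColumn t<k) ≡ mi k s t
starMI-cycle {k} s<k t<k with toℕ (cycleColumn t<k) <? k
... | yes lt = cong₂ (mi k) (toℕ-fromℕ< s<k) (trans (toℕ-fromℕ< lt) (toℕ-cycleColumn t<k))
... | no ≮  = contradiction (subst (_< k) (sym (toℕ-cycleColumn t<k)) t<k) ≮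

starMI-true : ∀ {k} i j → star (MI k) i j ≡ true → toℕ j ≡ toℕ i ⊎ toℕ j ≡ next k (toℕ i)
starMI-true {k} i j one with toℕ j <? k
... | yes lt =
  subst (λ x → x ≡ toℕ i ⊎ x ≡ next k (toℕ i)) (toℕ-fromℕ< lt) (Equivalence.to (mi-true k _ _) one)
... | no _   = contradiction one λ ()

-- The first cycle column c of a consecutive-ones order lies in the rows c and u = c - 1,
-- which contain its neighbours w = c + 1 and u respectively; whichever neighbour comes
-- first splits the row of the other one.
module _ {k : ℕ} (3≤k : 3 ≤ k) (q : Fin (suc k) → ℕ) (q-injective : Injective _≡_ _≡_ q)
         (convex : ∀ i → Convex q (star (MI k) i)) where

  first-cycleColumn-impossible : ∀ {c} (c<k : c < k) →
    (∀ {t} (t<k : t < k) → t ≢ c → q (cycleColumn c<k) < q (cycleColumn t<k)) → ⊥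
  first-cycleColumn-impossible {c} c<k first with predecessor c<k
  ... | u , u<k , next-u≡c = split (≢⇒<∨> q-injective (u≢w ∘ cycleColumn-injective {s<k = u<k} {w<k}))
    where
    w<k : next k c < k
    w<k = next-< c<k

    w≢c : next k c ≢ c
    w≢c = next-≢ (≤-trans (s≤s (s≤s z≤n)) 3≤k) c<k

    u≢c : u ≢ c
    u≢c u≡c = w≢c (subst (λ x → next k x ≡ c) u≡c next-u≡c)

    u≢w : u ≢ next k c
    u≢w u≡w = next²-≢ 3≤k c<k (subst (λ x → next k x ≡ c) u≡w next-u≡c)

    cycleColumn-injective : ∀ {s t} {s<k : s < k} {t<k : t < k} → cycleColumn s<k ≡ cycleColumn t<k → s ≡ t
    cycleColumn-injective {s<k = s<k} {t<k} eq =
      trans (sym (toℕ-cycleColumn s<k)) (trans (cong toℕ eq) (toℕ-cycleColumn t<k))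

    split : q (cycleColumn u<k) < q (cycleColumn w<k) ⊎ q (cycleColumn w<k) < q (cycleColumn u<k) → ⊥
    split (inj₁ u<w) = convex-gap (convex (fromℕ< c<k)) (first u<k u≢c) u<w
      (trans (starMI-cycle c<k c<k) (mi-self k c))
      (trans (starMI-cycle c<k w<k) (mi-next k c))
      (trans (starMI-cycle c<k u<k) (mi-other k u≢c u≢w))
    split (inj₂ w<u) = convex-gap (convex (fromℕ< u<k)) (first w<k w≢c) w<u
      (trans (starMI-cycle u<k c<k) (subst (λ x → mi k u x ≡ true) next-u≡c (mi-next k u)))
      (trans (starMI-cycle u<k u<k) (mi-self k u))
      (trans (starMI-cycle u<k w<k) (mi-other k (u≢w ∘ sym) (λ w≡next-u → w≢c (trans w≡next-u next-u≡c))))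

¬consecutiveOnes-MI : ∀ k → 3 ≤ k → ¬ ConsecutiveOnes (star (MI k))
¬consecutiveOnes-MI (suc k₀) 3≤k (q , q-injective , convex) with argmin (q ∘ inject₁)
... | c , c-minimal = first-cycleColumn-impossible 3≤k q q-injective convex (toℕ<n c) first
  where
  c-column : cycleColumn (toℕ<n c) ≡ inject₁ c
  c-column = cong inject₁ (fromℕ<-toℕ c (toℕ<n c))

  first : ∀ {t} (t<k : t < suc k₀) → t ≢ toℕ c → q (cycleColumn (toℕ<n c)) < q (cycleColumn t<k)
  first t<k t≢c = ≤∧≢⇒< (subst (λ x → q x ≤ _) (sym c-column) (c-minimal (fromℕ< t<k)))
    λ eq → t≢c (trans (sym (toℕ-cycleColumn t<k))
                      (trans (cong toℕ (sym (q-injective eq))) (toℕ-cycleColumn (toℕ<n c))))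

-- Cycle column t sits at 2t and the star column right behind cycle column c.
position : (k c : ℕ) → Fin (suc k) → ℕ
position k c x = if toℕ x <ᵇ k then 2 * toℕ x else suc (2 * c)

columnKind : ∀ {k} (x : Fin (suc k)) → toℕ x < k ⊎ toℕ x ≡ k
columnKind x = m<1+n⇒m<n∨m≡n (toℕ<n x)

position-cycle : ∀ {k} c x → toℕ x < k → position k c x ≡ 2 * toℕ x
position-cycle {k} c x lt with toℕ x <ᵇ k in eq
... | true  = refl
... | false = contradiction (<⇒<ᵇ lt) (subst T eq)

position-star : ∀ {k} c x → toℕ x ≡ k → position k c x ≡ suc (2 * c)
position-star {k} c x x≡k with toℕ x <ᵇ k in eq
... | true  = contradiction x≡k (<⇒≢ (<ᵇ⇒< _ _ (subst T (sym eq) _)))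
... | false = refl

position-at : ∀ {k} c x {t} → toℕ x ≡ t → t < k → position k c x ≡ 2 * t
position-at c x x≡t t<k = trans (position-cycle c x (subst (_< _) (sym x≡t) t<k)) (cong (2 *_) x≡t)

position-injective : ∀ {k c} → Injective _≡_ _≡_ (position k c)
position-injective {k} {c} {x} {y} eq with columnKind x | columnKind y
... | inj₁ x<k | inj₁ y<k =
  toℕ-injective (*-cancelˡ-≡ (toℕ x) (toℕ y) 2
    (trans (sym (position-cycle c x x<k)) (trans eq (position-cycle c y y<k))))
... | inj₂ x≡k | inj₂ y≡k = toℕ-injective (trans x≡k (sym y≡k))
... | inj₁ x<k | inj₂ y≡k =
  contradiction (trans (sym (position-cycle c x x<k)) (trans eq (position-star c y y≡k))) (even≢odd (toℕ x) c)
... | inj₂ x≡k | inj₁ y<k =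
  contradiction (trans (sym (position-cycle c y y<k)) (trans (sym eq) (position-star c x x≡k))) (even≢odd (toℕ y) c)

odd-above : ∀ {i c} → 2 * i < suc (2 * c) → i ≤ c
odd-above {i} {c} lt = *-cancelˡ-≤ {i} {c} 2 (s≤s⁻¹ lt)

odd-below : ∀ {i c} → suc (2 * c) < 2 * suc i → c ≤ i
odd-below {i} {c} lt = s≤s⁻¹ (*-cancelˡ-≤ {suc c} {suc i} 2 (subst (_≤ 2 * suc i) (sym (*-suc 2 c)) lt))

module _ {k c : ℕ} where

  ones-position : ∀ {n} (g : Fin n → Fin (suc k)) (i : Fin k) x → star (MI k) i (g x) ≡ true →
                  position k c (g x) ≡ 2 * toℕ i ⊎ position k c (g x) ≡ 2 * next k (toℕ i)
  ones-position g i x one with starMI-true i (g x) one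
  ... | inj₁ eq = inj₁ (position-at c (g x) eq (toℕ<n i))
  ... | inj₂ eq = inj₂ (position-at c (g x) eq (next-< (toℕ<n i)))

  -- The ones of row i sit at 2i and 2·next i, adjacent in the circular order of the positions
  -- unless the star column sits in between, which happens exactly when c = i.
  row-noAlternation : c < k → ∀ {n} (g : Fin n → Fin (suc k)) (i : Fin k) →
    (c ≡ toℕ i → ∀ x → toℕ (g x) ≢ k) → NoAlternation (position k c ∘ g) (star (MI k) i ∘ g)
  row-noAlternation c<k g i star-absent with stepOrWrap (toℕ<n i)
  ... | inj₁ step = noAlternation-pair (*-monoʳ-≤ 2 {toℕ i} (subst (toℕ i ≤_) (sym (next-step step)) (n≤1+n _)))
                      (ones-position g i) between
    where
    between : ∀ x y → 2 * toℕ i < position k c (g x) → position k c (g x) < 2 * next k (toℕ i) →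
              position k c (g y) < 2 * toℕ i ⊎ 2 * next k (toℕ i) < position k c (g y) → ⊥
    between x _ lt₁ lt₂ _ rewrite next-step step with columnKind (g x)
    ... | inj₁ t<k rewrite position-cycle c (g x) t<k =
      <⇒≱ (*-cancelˡ-< 2 (toℕ i) (toℕ (g x)) lt₁) (s≤s⁻¹ (*-cancelˡ-< 2 (toℕ (g x)) (suc (toℕ i)) lt₂))
    ... | inj₂ t≡k rewrite position-star c (g x) t≡k =
      star-absent (≤-antisym (odd-below lt₂) (odd-above lt₁)) x t≡k
  ... | inj₂ wrap = noAlternation-pair (subst (λ y → 2 * y ≤ 2 * toℕ i) (sym (next-wrap wrap)) z≤n)
                      (λ x → swap ∘ ones-position g i x) outside
    where
    outside : ∀ x y → 2 * next k (toℕ i) < position k c (g x) → position k c (g x) < 2 * toℕ i →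
              position k c (g y) < 2 * next k (toℕ i) ⊎ 2 * toℕ i < position k c (g y) → ⊥
    outside _ y _ _ (inj₁ lt) rewrite next-wrap wrap = n≮0 lt
    outside _ y _ _ (inj₂ lt) with columnKind (g y)
    ... | inj₁ t<k rewrite position-cycle c (g y) t<k =
      <⇒≱ (*-cancelˡ-< 2 (toℕ i) (toℕ (g y)) lt) (s≤s⁻¹ (subst (toℕ (g y) <_) (sym wrap) t<k))
    ... | inj₂ t≡k rewrite position-star c (g y) t≡k =
      star-absent (≤-antisym (s≤s⁻¹ (subst (c <_) (sym wrap) c<k)) (odd-above lt)) y t≡k

  -- Deleting column i itself leaves a single one in row i.
  ownColumnDeleted-noAlternation : ∀ (col : Fin (suc k)) (i : Fin k) → toℕ col ≡ toℕ i →
    NoAlternation (position k c ∘ punchIn col) (star (MI k) i ∘ punchIn col)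
  ownColumnDeleted-noAlternation col i col≡i =
    noAlternation-pair ≤-refl (λ x → inj₂ ∘ single x) (λ _ _ lt₁ lt₂ _ → <-asym lt₁ lt₂)
    where
    single : ∀ x → star (MI k) i (punchIn col x) ≡ true → position k c (punchIn col x) ≡ 2 * next k (toℕ i)
    single x one with starMI-true i (punchIn col x) one
    ... | inj₁ eq = contradiction (toℕ-injective (trans eq (sym col≡i))) (punchInᵢ≢i col x)
    ... | inj₂ eq = position-at c _ eq (next-< (toℕ<n i))

MI-rowDeleted : ∀ {k} (r : Fin (suc k)) → CircularOnes (deleteRow r (star (MI (suc k))))
MI-rowDeleted r = alternationFree⇒circularOnes (position _ (toℕ r) , position-injective {c = toℕ r} ,
  λ i → row-noAlternation (toℕ<n r) id (punchIn r i) λ r≡ _ _ → punchInᵢ≢i r i (toℕ-injective (sym r≡)))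

MI-columnDeleted : ∀ {k} (col : Fin (suc (suc k))) → CircularOnes (deleteColumn col (star (MI (suc k))))
MI-columnDeleted {k} col with columnKind col
... | inj₁ col<k = alternationFree⇒circularOnes
  (position _ (toℕ col) ∘ punchIn col , punchIn-injective col _ _ ∘ position-injective {c = toℕ col} , row)
  where
  row : ∀ i → NoAlternation (position _ (toℕ col) ∘ punchIn col) (star (MI (suc k)) i ∘ punchIn col)
  row i with toℕ col ≟ toℕ i
  ... | yes col≡i = ownColumnDeleted-noAlternation {c = toℕ col} col i col≡i
  ... | no col≢i  = row-noAlternation col<k (punchIn col) i (λ col≡i → contradiction col≡i col≢i)
... | inj₂ col≡k = alternationFree⇒circularOnes
  (position _ 0 ∘ punchIn col , punchIn-injective col _ _ ∘ position-injective {c = 0} ,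
   λ i → row-noAlternation z<s (punchIn col) i
           λ _ x x≡k → punchInᵢ≢i col x (toℕ-injective (trans x≡k (sym col≡k))))

MI*-minimalForbidden : ∀ k → 3 ≤ k → ∀ a → MinimalForbiddenC1P (a ⊙ star (MI k))
MI*-minimalForbidden (suc k) 3≤k = minimalForbidden-⊙
  (¬consecutiveOnes-MI _ 3≤k ∘ circularOnes⇒consecutiveOnes (fromℕ (suc k)) (star-last (MI (suc k))))
  MI-rowDeleted MI-columnDeleted

-- The matrix M_V*

-- The rows of M_V are {0,1}, {0,1,2,3}, {2,3} and {0,3,4}.  Once column 0 precedes column 3,
-- every placement of the columns 1, 2 and 4 leaves a gap in one of them.
MV-oriented : (q : Fin 6 → ℕ) → Injective _≡_ _≡_ q → (∀ i → Convex q (star MV i)) → q 0F < q 3F → ⊥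
MV-oriented q q-injective convex 0<3 with ≢⇒<∨> q-injective {1F} {0F} (λ ())
... | inj₂ 0<1 with ≢⇒<∨> q-injective {1F} {3F} (λ ())
...   | inj₁ 1<3 = convex-gap (convex 3F) 0<1 1<3 refl refl refl
...   | inj₂ 3<1 = convex-gap (convex 0F) 0<3 3<1 refl refl refl
MV-oriented q q-injective convex 0<3 | inj₁ 1<0 with ≢⇒<∨> q-injective {2F} {3F} (λ ())
...   | inj₁ 2<3 with ≢⇒<∨> q-injective {2F} {0F} (λ ())
...     | inj₂ 0<2 = convex-gap (convex 3F) 0<2 2<3 refl refl refl
...     | inj₁ 2<0 = convex-gap (convex 2F) 2<0 0<3 refl refl refl
MV-oriented q q-injective convex 0<3 | inj₁ 1<0 | inj₂ 3<2 with ≢⇒<∨> q-injective {4F} {0F} (λ ())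
...   | inj₁ 4<0 with ≢⇒<∨> q-injective {4F} {1F} (λ ())
...     | inj₂ 1<4 = convex-gap (convex 1F) 1<4 4<0 refl refl refl
...     | inj₁ 4<1 = convex-gap (convex 3F) 4<1 1<0 refl refl refl
MV-oriented q q-injective convex 0<3 | inj₁ 1<0 | inj₂ 3<2 | inj₂ 0<4 with ≢⇒<∨> q-injective {4F} {3F} (λ ())
...   | inj₁ 4<3 = convex-gap (convex 1F) 0<4 4<3 refl refl refl
...   | inj₂ 3<4 with ≢⇒<∨> q-injective {4F} {2F} (λ ())
...     | inj₁ 4<2 = convex-gap (convex 1F) 3<4 4<2 refl refl refl
...     | inj₂ 2<4 = convex-gap (convex 3F) 3<2 2<4 refl refl refl

¬consecutiveOnes-MV : ¬ ConsecutiveOnes (star MV)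
¬consecutiveOnes-MV (q , q-injective , convex) with ≢⇒<∨> q-injective {0F} {3F} (λ ())
... | inj₁ 0<3 = MV-oriented q q-injective convex 0<3
... | inj₂ 3<0 = MV-oriented reversed (reversed-injective q-injective) (reversed-convex ∘ convex) (reversed-< 3<0)
  where open Reversal q

¬circularOnes-MV : ¬ CircularOnes (star MV)
¬circularOnes-MV = ¬consecutiveOnes-MV ∘ circularOnes⇒consecutiveOnes (fromℕ 5) (star-last MV)

MV-rowDeleted : ∀ r → CircularOnes (deleteRow r (star MV))
MV-rowDeleted 0F = circularOnes-byPositions _ (0 ∷ 3 ∷ 2 ∷ 1 ∷ 5 ∷ 4 ∷ [])
MV-rowDeleted 1F = circularOnes-byPositions _ (0 ∷ 1 ∷ 3 ∷ 4 ∷ 5 ∷ 2 ∷ [])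
MV-rowDeleted 2F = circularOnes-byPositions _ (0 ∷ 1 ∷ 2 ∷ 5 ∷ 4 ∷ 3 ∷ [])
MV-rowDeleted 3F = circularOnes-byPositions _ (0 ∷ 1 ∷ 2 ∷ 3 ∷ 4 ∷ 5 ∷ [])

MV-columnDeleted : ∀ c → CircularOnes (deleteColumn c (star MV))
MV-columnDeleted 0F = circularOnes-byPositions _ (1 ∷ 2 ∷ 3 ∷ 4 ∷ 5 ∷ [])
MV-columnDeleted 1F = circularOnes-byPositions _ (0 ∷ 3 ∷ 2 ∷ 5 ∷ 4 ∷ [])
MV-columnDeleted 2F = circularOnes-byPositions _ (0 ∷ 1 ∷ 5 ∷ 4 ∷ 3 ∷ [])
MV-columnDeleted 3F = circularOnes-byPositions _ (0 ∷ 1 ∷ 2 ∷ 5 ∷ 4 ∷ [])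
MV-columnDeleted 4F = circularOnes-byPositions _ (0 ∷ 1 ∷ 3 ∷ 4 ∷ 2 ∷ [])
MV-columnDeleted 5F = circularOnes-byPositions _ (0 ∷ 1 ∷ 2 ∷ 3 ∷ 4 ∷ [])

MV*-minimalForbidden : ∀ a → MinimalForbiddenC1P (a ⊙ star MV)
MV*-minimalForbidden = minimalForbidden-⊙ ¬circularOnes-MV MV-rowDeleted MV-columnDeleted

lemma8 : ((k : ℕ) → 3 ≤ k → (a : Fin k → Bool) → MinimalForbiddenC1P (a ⊙ star (MI k)))
         × ((a : Fin 4 → Bool) → MinimalForbiddenC1P (a ⊙ star MV))
lemma8 = MI*-minimalForbidden , MV*-minimalForbidden
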